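{- For prime powers $q\equiv1\pmod 4$, let $m(q)=\min\{|S|: S\text{ is an identifying set in the Paley graph }P(q)\}$. Then $m(q)=\Theta(\log q)$ as $q\to\infty$; that is, there exist constants $0<c\le C$ such that $c\log q\le m(q)\le C\log q$ for all sufficiently large such $q$.
   Context: All graphs are finite, simple and undirected. For a prime power $q\equiv1\pmod 4$, the Paley graph $P(q)$ has as vertex set the finite field $F_q$, with distinct $i,j$ adjacent if and only if $i-j$ is a nonzero square in $F_q$. For a graph $G=(V,E)$ and $x\in V$, $N[x]=\{x\}\cup\{y: xy\in E\}$. A set $C\subseteq V$ is identifying if $N[x]\cap C\ne\emptyset$ for every $x\in V$ and $N[x]\cap C\neq N[y]\cap C$ for all distinct $x,y\in V$. -}

module Defs where

open import Level using (0ℓ)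
open import Data.Nat using (ℕ; suc; _^_; _≥_; _%_)
open import Data.Nat.Primality using (Prime)
open import Data.Fin using (Fin)
open import Data.Fin.Subset using (Subset; _∈_)
open import Data.Product using (Σ; ∃; ∃-syntax; _×_)
open import Data.Sum using (_⊎_)
open import Function.Bundles using (_⇔_)
open import Relation.Binary.PropositionalEquality using (_≡_; _≢_)
open import Relation.Nullary using (¬_)
open import Algebra.Structures using (IsCommutativeRing)

IsPrimePower : ℕ → Set
IsPrimePower q = Σ ℕ λ p → Σ ℕ λ k → Prime p × k ≥ 1 × q ≡ p ^ k

-- Since a finite field of order q is unique up to isomorphism, quantifying over
-- all such structures is the same as talking about F_q.
record FieldOn (q : ℕ) : Set where
  field
    _+_ _*_ : Fin q → Fin q → Fin q
    -_      : Fin q → Fin q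
    0# 1#   : Fin q
    isCommutativeRing : IsCommutativeRing _≡_ _+_ _*_ -_ 0# 1#
    1≢0     : 1# ≢ 0#
    inverse : ∀ x → x ≢ 0# → ∃[ y ] (x * y ≡ 1#)

module Paley {q : ℕ} (F : FieldOn q) where
  open FieldOn F

  IsNonzeroSquare : Fin q → Set
  IsNonzeroSquare x = x ≢ 0# × ∃[ y ] (y * y ≡ x)

  Adj : Fin q → Fin q → Set
  Adj i j = i ≢ j × IsNonzeroSquare (i + (- j))

  InN[_] : Fin q → Fin q → Set
  InN[ x ] y = y ≡ x ⊎ Adj x y

  IsIdentifying : Subset q → Set
  IsIdentifying C =
    (∀ x → ∃[ c ] (c ∈ C × InN[ x ] c)) ×
    (∀ x y → x ≢ y → ¬ (∀ c → c ∈ C → (InN[ x ] c ⇔ InN[ y ] c)))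

module Submission where

-- Lower bound: an identifying set C gives the q vertices pairwise different traces
-- C ∩ N[x], hence q ≤ 2 ^ ∣ C ∣.
-- Upper bound: C is identifying as soon as it meets N[x] for every x and N[x] △ N[y]
-- for every x ≢ y. In P(q) each of these q² sets has at least (q - 1)/2 ≥ q/4 elements:
-- N[x] contains x - s for every nonzero square s, and for x ≢ y every nonsquare r yields
-- the point z with x - z = r (y - z), which lies in exactly one of N[x], N[y] because
-- square · nonsquare is a nonsquare and nonsquare · nonsquare is a square.
-- By double counting some point lies in a quarter of the q² sets; taking it and recursing
-- on the sets it misses (at most 3/4 of them, and (4/3)³ ≥ 2) gives such a C with
-- 2 ^ ∣ C ∣ ≤ 2 (q²)³ ≤ q⁷.

open import Defs
open import Level using (0ℓ)
open import Data.Nat using (ℕ; zero; suc; _^_; _⊔_; _≤_; _<_; _≤?_; z≤n; s≤s)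
import Data.Nat as ℕ
open import Data.Nat.Properties using (≤-trans; ≤-reflexive; ≤-antisym; +-cancelˡ-≡; *-monoʳ-≤)
open import Data.Bool using (Bool; true; false; if_then_else_)
open import Data.Fin using (Fin; zero; suc; toℕ; _≟_; combine; remQuot)
import Data.Fin.Properties as Fin
open import Data.Fin.Subset using (Subset; inside; outside; _∈_; _∩_; _∪_; ∁; ⁅_⁆; ⊤; ⊥; ∣_∣)
open import Data.Fin.Subset.Properties
open import Data.Vec using (_∷_; []; here; there)
open import Data.List using (List; _∷_; []; length; map; filter)
import Data.List as List
open import Data.List.Properties using (length-tabulate)
open import Data.List.Relation.Unary.All as All using (All; _∷_; [])
open import Data.List.Relation.Unary.All.Properties using (filter⁺; tabulate⁺; tabulate⁻)
open import Data.Product using (∃-syntax; _×_; _,_; proj₁; proj₂; uncurry)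
import Data.Product as Product
open import Data.Product.Properties using (,-injective)
open import Data.Sum using (_⊎_; inj₁; inj₂; [_,_]′)
open import Function using (id; _∘_; case_of_; _⇔_; mk⇔; Equivalence)
open import Relation.Binary.PropositionalEquality using (_≡_; _≢_; refl; sym; trans; cong; cong₂; subst; module ≡-Reasoning)
open import Relation.Binary.Definitions using (tri<; tri≈; tri>)
open import Relation.Nullary using (¬_; Dec; yes; no; does; contradiction)
open import Relation.Nullary.Decidable using (¬?; _×-dec_; _⊎-dec_; decidable-stable)
open import Relation.Unary using (Pred; Decidable)
open import Algebra.Bundles using (CommutativeRing)

module Arithmetic where

  open import Data.Nat using (_+_; _*_; _%_; _/_)
  open import Data.Nat.DivMod using (m≡m%n+[m/n]*n)
  open import Data.Nat.Properties
  open import Data.Nat.Tactic.RingSolver using (solve-∀)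

  4a≤3b⇒2a³≤b³ : ∀ a b → 4 * a ≤ 3 * b → 2 * a ^ 3 ≤ b ^ 3
  4a≤3b⇒2a³≤b³ a b 4a≤3b = *-cancelˡ-≤ 32 (begin
    32 * (2 * a ^ 3)  ≡⟨ lhs a ⟩
    (4 * a) ^ 3       ≤⟨ ^-monoˡ-≤ 3 4a≤3b ⟩
    (3 * b) ^ 3       ≡⟨ rhs b ⟩
    27 * b ^ 3        ≤⟨ *-monoˡ-≤ (b ^ 3) (m≤m+n 27 5) ⟩
    32 * b ^ 3        ∎)
    where
    open ≤-Reasoning
    lhs : ∀ a → 32 * (2 * (a * (a * (a * 1)))) ≡ 4 * a * (4 * a * (4 * a * 1))
    lhs = solve-∀
    rhs : ∀ b → 3 * b * (3 * b * (3 * b * 1)) ≡ 27 * (b * (b * (b * 1)))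
    rhs = solve-∀

  1+2h≤4h : ∀ {h} → 2 ≤ suc (h + h) → suc (h + h) ≤ 4 * h
  1+2h≤4h {zero} (s≤s ())
  1+2h≤4h {suc h} _ = subst (suc (suc h + suc h) ≤_) (sym (split h)) (m≤m+n _ _)
    where
    split : ∀ h → 4 * suc h ≡ suc (suc h + suc h) + suc (h + h)
    split = solve-∀

  1mod4⇒odd : ∀ {q} → q % 4 ≡ 1 → ∀ k → q ≢ k + k
  1mod4⇒odd {q} q%4≡1 k q≡k+k = even≢odd k (2 * (q / 4)) (begin
    2 * k                       ≡⟨ double k ⟩
    k + k                       ≡⟨ sym q≡k+k ⟩
    q                           ≡⟨ m≡m%n+[m/n]*n q 4 ⟩
    q % 4 + q / 4 * 4           ≡⟨ cong (_+ q / 4 * 4) q%4≡1 ⟩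
    suc (q / 4 * 4)             ≡⟨ cong suc (quadruple (q / 4)) ⟩
    suc (2 * (2 * (q / 4)))     ∎)
    where
    open ≡-Reasoning
    double : ∀ k → 2 * k ≡ k + k
    double = solve-∀
    quadruple : ∀ d → d * 4 ≡ 2 * (2 * d)
    quadruple = solve-∀

  1⊔2[q²]³≤q⁷ : ∀ {q} → 2 ≤ q → 1 ⊔ 2 * (q * q) ^ 3 ≤ q ^ 7
  1⊔2[q²]³≤q⁷ {q} 2≤q = ⊔-lub (^-monoˡ-≤ 7 {1} {q} (≤-trans (s≤s z≤n) 2≤q)) (begin
    2 * (q * q) ^ 3    ≡⟨ cong (2 *_) (sixth q) ⟩
    2 * q ^ 6          ≤⟨ *-monoˡ-≤ (q ^ 6) 2≤q ⟩
    q ^ 7              ∎)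
    where
    open ≤-Reasoning
    sixth : ∀ q → q * q * (q * q * (q * q * 1)) ≡ q * (q * (q * (q * (q * (q * 1)))))
    sixth = solve-∀

open Arithmetic

module SubsetCounting where

  open import Data.Nat using (_+_)
  open import Data.Nat.Properties using (+-suc; +-monoʳ-≤; ≤-<-trans; <⇒≱)
  open import Data.Fin.Subset using (_-_)
  open import Data.Vec using (tabulate)
  import Data.Vec.Properties as Vec
  open import Data.Bool.Properties using (T-≡)
  open import Relation.Nullary.Decidable using (dec-true; isYes≗does; toWitness)

  subset : ∀ {n ℓ} {P : Pred (Fin n) ℓ} → Decidable P → Subset n
  subset P? = tabulate (does ∘ P?)

  ∈-subset : ∀ {n ℓ} {P : Pred (Fin n) ℓ} (P? : Decidable P) {x} → x ∈ subset P? ⇔ P x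
  ∈-subset P? {x} = mk⇔
    (λ x∈ → toWitness (Equivalence.from T-≡ (trans (isYes≗does (P? x)) (trans (sym (Vec.lookup∘tabulate _ x)) (Vec.[]=⇒lookup x∈)))))
    (λ px → Vec.lookup⇒[]= x _ (trans (Vec.lookup∘tabulate _ x) (dec-true (P? x) px)))

  injective⇒∣p∣≤∣r∣ : ∀ {n m} {p : Subset n} {r : Subset m} (f : Fin n → Fin m) →
    (∀ {x} → x ∈ p → f x ∈ r) →
    (∀ {x y} → x ∈ p → y ∈ p → f x ≡ f y → x ≡ y) →
    ∣ p ∣ ≤ ∣ r ∣
  injective⇒∣p∣≤∣r∣ {p = []} f maps inj = z≤n
  injective⇒∣p∣≤∣r∣ {p = outside ∷ p} f maps inj =
    injective⇒∣p∣≤∣r∣ (f ∘ suc) (maps ∘ there) (λ x∈ y∈ e → Fin.suc-injective (inj (there x∈) (there y∈) e))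
  injective⇒∣p∣≤∣r∣ {p = inside ∷ p} {r = r} f maps inj =
    ≤-<-trans (injective⇒∣p∣≤∣r∣ {r = r - f zero} (f ∘ suc) maps′ inj′) (x∈p⇒∣p-x∣<∣p∣ (maps here))
    where
    maps′ : ∀ {x} → x ∈ p → f (suc x) ∈ r - f zero
    maps′ x∈ = x∈p∧x≢y⇒x∈p-y (maps (there x∈)) (λ e → case inj (there x∈) here e of λ ())
    inj′ : ∀ {x y} → x ∈ p → y ∈ p → f (suc x) ≡ f (suc y) → x ≡ y
    inj′ x∈ y∈ e = Fin.suc-injective (inj (there x∈) (there y∈) e)

  injective⇒onto : ∀ {n m} {p : Subset n} {r : Subset m} (f : Fin n → Fin m) →
    (∀ {x} → x ∈ p → f x ∈ r) →
    (∀ {x y} → x ∈ p → y ∈ p → f x ≡ f y → x ≡ y) →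
    ∣ r ∣ ≤ ∣ p ∣ → ∀ {y} → y ∈ r → ∃[ x ] (x ∈ p × f x ≡ y)
  injective⇒onto {p = p} {r} f maps inj r≤p {y} y∈r
    with Fin.any? (λ x → (x ∈? p) ×-dec (f x ≟ y))
  ... | yes hit = hit
  ... | no miss = contradiction r≤p (<⇒≱ (≤-<-trans p≤r-y (x∈p⇒∣p-x∣<∣p∣ y∈r)))
    where
    p≤r-y : ∣ p ∣ ≤ ∣ r - y ∣
    p≤r-y = injective⇒∣p∣≤∣r∣ f (λ x∈ → x∈p∧x≢y⇒x∈p-y (maps x∈) (λ e → miss (_ , x∈ , e))) inj

  ∣p∩q∣+∣p∩∁q∣≡∣p∣ : ∀ {n} (p q : Subset n) → ∣ p ∩ q ∣ + ∣ p ∩ ∁ q ∣ ≡ ∣ p ∣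
  ∣p∩q∣+∣p∩∁q∣≡∣p∣ []            []            = refl
  ∣p∩q∣+∣p∩∁q∣≡∣p∣ (outside ∷ p) (_ ∷ q)       = ∣p∩q∣+∣p∩∁q∣≡∣p∣ p q
  ∣p∩q∣+∣p∩∁q∣≡∣p∣ (inside ∷ p)  (inside ∷ q)  = cong suc (∣p∩q∣+∣p∩∁q∣≡∣p∣ p q)
  ∣p∩q∣+∣p∩∁q∣≡∣p∣ (inside ∷ p)  (outside ∷ q) = trans (+-suc _ _) (cong suc (∣p∩q∣+∣p∩∁q∣≡∣p∣ p q))

  ∣p∪q∣≤∣p∣+∣q∣ : ∀ {n} (p q : Subset n) → ∣ p ∪ q ∣ ≤ ∣ p ∣ + ∣ q ∣
  ∣p∪q∣≤∣p∣+∣q∣ []            []            = z≤n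
  ∣p∪q∣≤∣p∣+∣q∣ (inside ∷ p)  (s ∷ q)       = s≤s (≤-trans (∣p∪q∣≤∣p∣+∣q∣ p q) (+-monoʳ-≤ ∣ p ∣ (∣p∣≤∣x∷p∣ s q)))
  ∣p∪q∣≤∣p∣+∣q∣ (outside ∷ p) (inside ∷ q)  = ≤-trans (s≤s (∣p∪q∣≤∣p∣+∣q∣ p q)) (≤-reflexive (sym (+-suc ∣ p ∣ ∣ q ∣)))
  ∣p∪q∣≤∣p∣+∣q∣ (outside ∷ p) (outside ∷ q) = ∣p∪q∣≤∣p∣+∣q∣ p q

  ascending : ∀ {n} → (Fin n → Fin n) → Subset n
  ascending σ = subset (λ x → x Fin.<? σ x)

  ∈-ascending : ∀ {n} (σ : Fin n → Fin n) {x} → x ∈ ascending σ ⇔ toℕ x < toℕ (σ x)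
  ∈-ascending σ = ∈-subset (λ y → y Fin.<? σ y)

  involution⇒∣p∣≡2∣p∩ascending∣ : ∀ {n} {p : Subset n} (σ : Fin n → Fin n) →
    (∀ {x} → x ∈ p → σ x ∈ p) → (∀ x → σ (σ x) ≡ x) → (∀ {x} → x ∈ p → σ x ≢ x) →
    ∣ p ∣ ≡ ∣ p ∩ ascending σ ∣ + ∣ p ∩ ascending σ ∣
  involution⇒∣p∣≡2∣p∩ascending∣ {p = p} σ closed σσ no-fix = begin
    ∣ p ∣                         ≡⟨ sym (∣p∩q∣+∣p∩∁q∣≡∣p∣ p up) ⟩
    ∣ p ∩ up ∣ + ∣ p ∩ ∁ up ∣     ≡⟨ cong (∣ p ∩ up ∣ +_) (≤-antisym (injective⇒∣p∣≤∣r∣ σ down⇒up σ-inj) (injective⇒∣p∣≤∣r∣ σ up⇒down σ-inj)) ⟩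
    ∣ p ∩ up ∣ + ∣ p ∩ up ∣       ∎
    where
    open ≡-Reasoning
    up = ascending σ
    σ-inj : ∀ {x y} {s : Subset _} → x ∈ s → y ∈ s → σ x ≡ σ y → x ≡ y
    σ-inj _ _ e = trans (sym (σσ _)) (trans (cong σ e) (σσ _))
    up⇒down : ∀ {x} → x ∈ p ∩ up → σ x ∈ p ∩ ∁ up
    up⇒down {x} x∈ with x∈p∩q⁻ p up x∈
    ... | x∈p , x↑ = x∈p∩q⁺ (closed x∈p , x∉p⇒x∈∁p (λ σx↑ →
      Fin.<-asym (Equivalence.to (∈-ascending σ) x↑) (subst (λ y → toℕ (σ x) < toℕ y) (σσ x) (Equivalence.to (∈-ascending σ) σx↑))))
    down⇒up : ∀ {x} → x ∈ p ∩ ∁ up → σ x ∈ p ∩ up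
    down⇒up {x} x∈ with x∈p∩q⁻ p (∁ up) x∈
    ... | x∈p , x↓ with Fin.<-cmp x (σ x)
    ... | tri< x<σx _ _ = contradiction (Equivalence.from (∈-ascending σ) x<σx) (x∈∁p⇒x∉p x↓)
    ... | tri≈ _ x≡σx _ = contradiction (sym x≡σx) (no-fix x∈p)
    ... | tri> _ _ σx<x = x∈p∩q⁺ (closed x∈p , Equivalence.from (∈-ascending σ) (subst (λ y → toℕ (σ x) < toℕ y) (sym (σσ x)) σx<x))

open SubsetCounting

bit : Bool → Fin 2
bit false = zero
bit true  = suc zero

bit-injective : ∀ {b b′} → bit b ≡ bit b′ → b ≡ b′
bit-injective {false} {false} _ = refl
bit-injective {true}  {true}  _ = refl

-- D ∩ C, encoded as a number below 2 ^ ∣ C ∣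
trace : ∀ {n} (C D : Subset n) → Fin (2 ^ ∣ C ∣)
trace []            []      = zero
trace (outside ∷ C) (_ ∷ D) = trace C D
trace (inside ∷ C)  (b ∷ D) = combine (bit b) (trace C D)

trace-injective : ∀ {n} (C D D′ : Subset n) → trace C D ≡ trace C D′ → C ∩ D ≡ C ∩ D′
trace-injective []            []      []        _ = refl
trace-injective (outside ∷ C) (_ ∷ D) (_ ∷ D′)  e = cong (outside ∷_) (trace-injective C D D′ e)
trace-injective (inside ∷ C)  (b ∷ D) (b′ ∷ D′) e with ,-injective (trans (sym (Fin.remQuot-combine _ _)) (trans (cong (remQuot _) e) (Fin.remQuot-combine _ _)))
... | bits , traces = cong₂ _∷_ (bit-injective bits) (trace-injective C D D′ traces)

separating-family-size : ∀ {m n} (C : Subset n) (D : Fin m → Subset n) →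
  (∀ {x y} → C ∩ D x ≡ C ∩ D y → x ≡ y) → m ≤ 2 ^ ∣ C ∣
separating-family-size C D separates = Fin.injective⇒≤ (λ e → separates (trace-injective C (D _) (D _) e))

module HittingSets where

  open import Data.Nat using (_+_; _*_)
  open import Data.Nat.Properties
  open import Data.Nat.ListAction using (sum)
  open import Data.Nat.Tactic.RingSolver using (solve-∀)
  open import Algebra.Properties.CommutativeMonoid.Sum +-0-commutativeMonoid using (sum-cong-≗; sum-replicate-zero; ∑-distrib-+) renaming (sum to ∑)

  module _ {a p} {A : Set a} {P : Pred A p} (P? : Decidable P) where

    length-filter+length-filter-¬ : ∀ xs → length (filter P? xs) + length (filter (¬? ∘ P?) xs) ≡ length xs
    length-filter+length-filter-¬ [] = refl
    length-filter+length-filter-¬ (x ∷ xs) with does (P? x)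
    ... | true  = cong suc (length-filter+length-filter-¬ xs)
    ... | false = trans (+-suc _ _) (cong suc (length-filter+length-filter-¬ xs))

    All-filter-¬⁻ : ∀ {q} {Q : Pred A q} {xs} → (∀ {x} → P x → Q x) → All Q (filter (¬? ∘ P?) xs) → All Q xs
    All-filter-¬⁻ {xs = []}     _ _ = []
    All-filter-¬⁻ {xs = x ∷ xs} P⇒Q Qs with P? x
    ... | yes px = P⇒Q px ∷ All-filter-¬⁻ P⇒Q Qs
    All-filter-¬⁻ {xs = x ∷ xs} P⇒Q (Qx ∷ Qs) | no _ = Qx ∷ All-filter-¬⁻ P⇒Q Qs

  module _ {n : ℕ} where

    Large : Subset n → Set
    Large r = n ≤ 4 * ∣ r ∣

    Meets : Subset n → Subset n → Set
    Meets h r = ∃[ x ] (x ∈ h × x ∈ r)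

    degree : Fin n → List (Subset n) → ℕ
    degree x L = length (filter (x ∈?_) L)

    χ : Subset n → Fin n → ℕ
    χ r x = if does (x ∈? r) then 1 else 0

    degree-∷ : ∀ x r L → degree x (r ∷ L) ≡ χ r x + degree x L
    degree-∷ x r L with does (x ∈? r)
    ... | true  = refl
    ... | false = refl

  ∑χ≡∣∣ : ∀ {n} (r : Subset n) → ∑ (χ r) ≡ ∣ r ∣
  ∑χ≡∣∣ []            = refl
  ∑χ≡∣∣ (inside ∷ r)  = cong suc (∑χ≡∣∣ r)
  ∑χ≡∣∣ (outside ∷ r) = ∑χ≡∣∣ r

  ∑degree≡∑∣∣ : ∀ {n} (L : List (Subset n)) → ∑ (λ x → degree x L) ≡ sum (map ∣_∣ L)
  ∑degree≡∑∣∣ {n} [] = sum-replicate-zero n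
  ∑degree≡∑∣∣ (r ∷ L) = begin
    ∑ (λ x → degree x (r ∷ L))         ≡⟨ sum-cong-≗ (λ x → degree-∷ x r L) ⟩
    ∑ (λ x → χ r x + degree x L)       ≡⟨ ∑-distrib-+ (χ r) (λ x → degree x L) ⟩
    ∑ (χ r) + ∑ (λ x → degree x L)     ≡⟨ cong₂ _+_ (∑χ≡∣∣ r) (∑degree≡∑∣∣ L) ⟩
    ∣ r ∣ + sum (map ∣_∣ L)            ∎
    where open ≡-Reasoning

  ∑-bounded : ∀ {n} k c (f : Fin n → ℕ) → (∀ x → suc (k * f x) ≤ c) → n + k * ∑ f ≤ n * c
  ∑-bounded {zero}  k c f bound = ≤-reflexive (*-zeroʳ k)
  ∑-bounded {suc n} k c f bound = begin
    suc n + k * (f zero + ∑ (f ∘ suc))          ≡⟨ shuffle n k (f zero) (∑ (f ∘ suc)) ⟩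
    suc (k * f zero) + (n + k * ∑ (f ∘ suc))    ≤⟨ +-mono-≤ (bound zero) (∑-bounded k c (f ∘ suc) (bound ∘ suc)) ⟩
    c + n * c                                   ∎
    where
    open ≤-Reasoning
    shuffle : ∀ n k a s → suc n + k * (a + s) ≡ suc (k * a) + (n + k * s)
    shuffle = solve-∀

  ∣L∣*n≤4∑∣∣ : ∀ {n} {L : List (Subset n)} → All Large L → length L * n ≤ 4 * sum (map ∣_∣ L)
  ∣L∣*n≤4∑∣∣ []                   = z≤n
  ∣L∣*n≤4∑∣∣ {L = r ∷ L} (n≤4∣r∣ ∷ large) =
    ≤-trans (+-mono-≤ n≤4∣r∣ (∣L∣*n≤4∑∣∣ large)) (≤-reflexive (sym (*-distribˡ-+ 4 ∣ r ∣ (sum (map ∣_∣ L)))))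

  popular-point : ∀ {n} → 1 ≤ n → (L : List (Subset n)) → All Large L → ∃[ x ] length L ≤ 4 * degree x L
  popular-point {n} 1≤n L large with Fin.any? (λ x → length L ≤? 4 * degree x L)
  ... | yes found = found
  ... | no none   = contradiction (≤-trans 1≤n (+-cancelʳ-≤ (length L * n) n 0 overfull)) λ ()
    where
    open ≤-Reasoning
    overfull : n + length L * n ≤ length L * n
    overfull = begin
      n + length L * n                       ≤⟨ +-monoʳ-≤ n (∣L∣*n≤4∑∣∣ large) ⟩
      n + 4 * sum (map ∣_∣ L)                ≡⟨ cong (λ s → n + 4 * s) (sym (∑degree≡∑∣∣ L)) ⟩
      n + 4 * ∑ (λ x → degree x L)           ≤⟨ ∑-bounded 4 (length L) (λ x → degree x L) (λ x → ≰⇒> (none ∘ (x ,_))) ⟩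
      n * length L                           ≡⟨ *-comm n (length L) ⟩
      length L * n                           ∎

  removing-a-quarter : ∀ {l a b} → 1 ≤ l → l ≤ 4 * a → a + b ≡ l → b < l × 4 * b ≤ 3 * l
  removing-a-quarter {l} {zero}  {b} 1≤l l≤4a _ = contradiction (≤-trans 1≤l l≤4a) λ ()
  removing-a-quarter {l} {suc a} {b} 1≤l l≤4a a+b≡l =
    subst (b <_) a+b≡l (m<n+m b (s≤s z≤n)) ,
    +-cancelʳ-≤ l (4 * b) (3 * l) (begin
      4 * b + l            ≤⟨ +-monoʳ-≤ (4 * b) l≤4a ⟩
      4 * b + 4 * suc a    ≡⟨ sym (*-distribˡ-+ 4 b (suc a)) ⟩
      4 * (b + suc a)      ≡⟨ cong (4 *_) (trans (+-comm b (suc a)) a+b≡l) ⟩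
      4 * l                ≡⟨ four l ⟩
      3 * l + l            ∎)
    where
    open ≤-Reasoning
    four : ∀ l → 4 * l ≡ 3 * l + l
    four = solve-∀

  hitting-set : ∀ {n} → 1 ≤ n → (L : List (Subset n)) → All Large L →
    ∃[ h ] (All (Meets h) L × 2 ^ ∣ h ∣ ≤ 1 ⊔ 2 * length L ^ 3)
  hitting-set {n} 1≤n L = go L (length L) ≤-refl
    where
    go : (L : List (Subset n)) (k : ℕ) → length L ≤ k → All Large L →
      ∃[ h ] (All (Meets h) L × 2 ^ ∣ h ∣ ≤ 1 ⊔ 2 * length L ^ 3)
    go []      _ _ _ = ⊥ , [] , subst (λ m → 2 ^ m ≤ 1) (sym (∣⊥∣≡0 n)) ≤-refl
    go (_ ∷ _) zero () _
    go L@(_ ∷ _) (suc k) |L|≤1+k large = ⁅ v ⁆ ∪ h′ , meets , bound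
      where
      popular : ∃[ x ] length L ≤ 4 * degree x L
      popular = popular-point 1≤n L large
      v : Fin n
      v = proj₁ popular
      missed : List (Subset n)
      missed = filter (¬? ∘ (v ∈?_)) L
      shrinks : length missed < length L × 4 * length missed ≤ 3 * length L
      shrinks = removing-a-quarter {length L} {degree v L} (s≤s z≤n) (proj₂ popular) (length-filter+length-filter-¬ (v ∈?_) L)
      rest : ∃[ h ] (All (Meets h) missed × 2 ^ ∣ h ∣ ≤ 1 ⊔ 2 * length missed ^ 3)
      rest = go missed k (≤-pred (≤-trans (proj₁ shrinks) |L|≤1+k)) (filter⁺ (¬? ∘ (v ∈?_)) large)
      h′ : Subset n
      h′ = proj₁ rest
      meets : All (Meets (⁅ v ⁆ ∪ h′)) L
      meets = All-filter-¬⁻ (v ∈?_) (λ v∈r → v , x∈p∪q⁺ (inj₁ (x∈⁅x⁆ v)) , v∈r)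
        (All.map (λ (x , x∈h′ , x∈r) → x , x∈p∪q⁺ (inj₂ x∈h′) , x∈r) (proj₁ (proj₂ rest)))
      bound : 2 ^ ∣ ⁅ v ⁆ ∪ h′ ∣ ≤ 1 ⊔ 2 * length L ^ 3
      bound = begin
        2 ^ ∣ ⁅ v ⁆ ∪ h′ ∣                      ≤⟨ ^-monoʳ-≤ 2 (≤-trans (∣p∪q∣≤∣p∣+∣q∣ ⁅ v ⁆ h′) (≤-reflexive (cong (_+ ∣ h′ ∣) (∣⁅x⁆∣≡1 v)))) ⟩
        2 * 2 ^ ∣ h′ ∣                          ≤⟨ *-monoʳ-≤ 2 (proj₂ (proj₂ rest)) ⟩
        2 * (1 ⊔ 2 * length missed ^ 3)         ≤⟨ *-monoʳ-≤ 2 (⊔-lub (^-monoˡ-≤ 3 {1} {length L} (s≤s z≤n)) (4a≤3b⇒2a³≤b³ (length missed) (length L) (proj₂ shrinks))) ⟩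
        2 * length L ^ 3                        ≤⟨ m≤n⊔m 1 _ ⟩
        1 ⊔ 2 * length L ^ 3                    ∎
        where open ≤-Reasoning

open HittingSets

module FieldProperties {q : ℕ} (F : FieldOn q) where

  open FieldOn F using (0#; 1#; 1≢0; inverse) renaming (_+_ to infixl 6 _+_; _*_ to infixl 7 _*_; -_ to infix 8 -_)

  ring : CommutativeRing 0ℓ 0ℓ
  ring = record { isCommutativeRing = FieldOn.isCommutativeRing F }

  open CommutativeRing ring using
    ( +-assoc; +-comm; +-identityˡ; +-identityʳ; -‿inverseˡ; -‿inverseʳ
    ; *-assoc; *-comm; *-identityˡ; *-identityʳ; distribˡ; zeroʳ; +-abelianGroup; *-commutativeSemigroup)
  open import Algebra.Properties.Ring (CommutativeRing.ring ring) using (-‿distribˡ-*; -‿distribʳ-*; [y-z]x≈yx-zx)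
  open import Algebra.Properties.AbelianGroup +-abelianGroup using (⁻¹-involutive; ⁻¹-injective; ⁻¹-anti-homo‿-; xyx⁻¹≈y; ⁻¹-∙-comm; x∙y⁻¹≈ε⇒x≈y; ε⁻¹≈ε)
  open import Algebra.Properties.CommutativeSemigroup *-commutativeSemigroup using (interchange)
  open Paley F using (IsNonzeroSquare)
  open ≡-Reasoning

  infixl 6 _-_
  _-_ : Fin q → Fin q → Fin q
  x - y = x + - y

  infix 9 _⁻¹
  -- total inverse, with the junk value 0# ⁻¹ = 0#
  _⁻¹ : Fin q → Fin q
  x ⁻¹ with x ≟ 0#
  ... | yes _   = 0#
  ... | no x≢0 = proj₁ (inverse x x≢0)

  *-inverseʳ : ∀ {x} → x ≢ 0# → x * x ⁻¹ ≡ 1#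
  *-inverseʳ {x} x≢0 with x ≟ 0#
  ... | yes x≡0  = contradiction x≡0 x≢0
  ... | no x≢0′ = proj₂ (inverse x x≢0′)

  *-cancelʳ : ∀ {w} a b → w ≢ 0# → a * w ≡ b * w → a ≡ b
  *-cancelʳ {w} a b w≢0 e = begin
    a                ≡⟨ sym (*-identityʳ a) ⟩
    a * 1#           ≡⟨ cong (a *_) (sym (*-inverseʳ w≢0)) ⟩
    a * (w * w ⁻¹)   ≡⟨ sym (*-assoc a w _) ⟩
    a * w * w ⁻¹     ≡⟨ cong (_* w ⁻¹) e ⟩
    b * w * w ⁻¹     ≡⟨ *-assoc b w _ ⟩
    b * (w * w ⁻¹)   ≡⟨ cong (b *_) (*-inverseʳ w≢0) ⟩
    b * 1#           ≡⟨ *-identityʳ b ⟩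
    b                ∎

  *-integral : ∀ x y → x * y ≡ 0# → x ≡ 0# ⊎ y ≡ 0#
  *-integral x y xy≡0 with y ≟ 0#
  ... | yes y≡0 = inj₂ y≡0
  ... | no y≢0  = inj₁ (*-cancelʳ x 0# y≢0 (trans xy≡0 (sym (trans (*-comm 0# y) (zeroʳ y)))))

  *-nonzero : ∀ {x y} → x ≢ 0# → y ≢ 0# → x * y ≢ 0#
  *-nonzero {x} {y} x≢0 y≢0 xy≡0 with *-integral x y xy≡0
  ... | inj₁ x≡0 = x≢0 x≡0
  ... | inj₂ y≡0 = y≢0 y≡0

  -x≢0 : ∀ {x} → x ≢ 0# → - x ≢ 0#
  -x≢0 x≢0 -x≡0 = x≢0 (⁻¹-injective (trans -x≡0 (sym ε⁻¹≈ε)))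

  -x*-y≡x*y : ∀ x y → - x * - y ≡ x * y
  -x*-y≡x*y x y = begin
    - x * - y       ≡⟨ sym (-‿distribˡ-* x (- y)) ⟩
    - (x * - y)     ≡⟨ cong -_ (sym (-‿distribʳ-* x y)) ⟩
    - - (x * y)     ≡⟨ ⁻¹-involutive (x * y) ⟩
    x * y           ∎

  x-[x-y]≡y : ∀ x y → x - (x - y) ≡ y
  x-[x-y]≡y x y = begin
    x + - (x - y)   ≡⟨ cong (x +_) (⁻¹-anti-homo‿- x y) ⟩
    x + (y - x)     ≡⟨ sym (+-assoc x y (- x)) ⟩
    x + y - x       ≡⟨ xyx⁻¹≈y x y ⟩
    y               ∎

  [a+b]-[b+c]≡a-c : ∀ a b c → (a + b) - (b + c) ≡ a - c
  [a+b]-[b+c]≡a-c a b c = begin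
    (a + b) + - (b + c)     ≡⟨ cong ((a + b) +_) (sym (⁻¹-∙-comm b c)) ⟩
    (a + b) + (- b + - c)   ≡⟨ +-assoc a b _ ⟩
    a + (b + (- b + - c))   ≡⟨ cong (a +_) (sym (+-assoc b (- b) (- c))) ⟩
    a + ((b - b) + - c)     ≡⟨ cong (λ t → a + (t + - c)) (-‿inverseʳ b) ⟩
    a + (0# + - c)          ≡⟨ cong (a +_) (+-identityˡ (- c)) ⟩
    a - c                   ∎

  difference-of-squares : ∀ x y → (x - y) * (x + y) ≡ x * x - y * y
  difference-of-squares x y = begin
    (x - y) * (x + y)                    ≡⟨ [y-z]x≈yx-zx (x + y) x y ⟩
    x * (x + y) - y * (x + y)            ≡⟨ cong₂ _-_ (distribˡ x x y) (distribˡ y x y) ⟩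
    (x * x + x * y) - (y * x + y * y)    ≡⟨ cong (λ t → (x * x + x * y) - (t + y * y)) (*-comm y x) ⟩
    (x * x + x * y) - (x * y + y * y)    ≡⟨ [a+b]-[b+c]≡a-c (x * x) (x * y) (y * y) ⟩
    x * x - y * y                        ∎

  square-injective : ∀ {x y} → x * x ≡ y * y → x ≡ y ⊎ x ≡ - y
  square-injective {x} {y} e with *-integral (x - y) (x + y) (trans (difference-of-squares x y) (trans (cong (_- y * y) e) (-‿inverseʳ (y * y))))
  ... | inj₁ x-y≡0 = inj₁ (x∙y⁻¹≈ε⇒x≈y x y x-y≡0)
  ... | inj₂ x+y≡0 = inj₂ (x∙y⁻¹≈ε⇒x≈y x (- y) (trans (cong (x +_) (⁻¹-involutive y)) x+y≡0))

  square-quotient : ∀ {a u t} → u ≢ 0# → a * (u * u) ≡ t * t → a ≡ (t * u ⁻¹) * (t * u ⁻¹)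
  square-quotient {a} {u} {t} u≢0 e = sym (begin
    (t * u ⁻¹) * (t * u ⁻¹)          ≡⟨ interchange t (u ⁻¹) t (u ⁻¹) ⟩
    (t * t) * (u ⁻¹ * u ⁻¹)          ≡⟨ cong (_* (u ⁻¹ * u ⁻¹)) (sym e) ⟩
    a * (u * u) * (u ⁻¹ * u ⁻¹)      ≡⟨ *-assoc a (u * u) _ ⟩
    a * ((u * u) * (u ⁻¹ * u ⁻¹))    ≡⟨ cong (a *_) (interchange u u (u ⁻¹) (u ⁻¹)) ⟩
    a * ((u * u ⁻¹) * (u * u ⁻¹))    ≡⟨ cong (λ t → a * (t * t)) (*-inverseʳ u≢0) ⟩
    a * (1# * 1#)                    ≡⟨ cong (a *_) (*-identityʳ 1#) ⟩
    a * 1#                           ≡⟨ *-identityʳ a ⟩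
    a                                ∎)

  x-[y-w]≡[x-y]+w : ∀ x y w → x - (y - w) ≡ (x - y) + w
  x-[y-w]≡[x-y]+w x y w = begin
    x + - (y - w)     ≡⟨ cong (x +_) (⁻¹-anti-homo‿- y w) ⟩
    x + (w - y)       ≡⟨ cong (x +_) (+-comm w (- y)) ⟩
    x + (- y + w)     ≡⟨ sym (+-assoc x (- y) w) ⟩
    x - y + w         ∎

  [r-1]*w+w≡r*w : ∀ r w → (r - 1#) * w + w ≡ r * w
  [r-1]*w+w≡r*w r w = begin
    (r - 1#) * w + w          ≡⟨ cong (_+ w) ([y-z]x≈yx-zx w r 1#) ⟩
    r * w - 1# * w + w        ≡⟨ cong (λ t → r * w - t + w) (*-identityˡ w) ⟩
    r * w - w + w             ≡⟨ +-assoc (r * w) (- w) w ⟩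
    r * w + (- w + w)         ≡⟨ cong (r * w +_) (-‿inverseˡ w) ⟩
    r * w + 0#                ≡⟨ +-identityʳ (r * w) ⟩
    r * w                     ∎

  a*b⁻¹*b≡a : ∀ a {b} → b ≢ 0# → a * b ⁻¹ * b ≡ a
  a*b⁻¹*b≡a a {b} b≢0 = begin
    a * b ⁻¹ * b     ≡⟨ *-assoc a (b ⁻¹) b ⟩
    a * (b ⁻¹ * b)   ≡⟨ cong (a *_) (trans (*-comm (b ⁻¹) b) (*-inverseʳ b≢0)) ⟩
    a * 1#           ≡⟨ *-identityʳ a ⟩
    a                ∎

  ⁻¹≢0 : ∀ {x} → x ≢ 0# → x ⁻¹ ≢ 0#
  ⁻¹≢0 {x} x≢0 x⁻¹≡0 = 1≢0 (trans (sym (*-inverseʳ x≢0)) (trans (cong (x *_) x⁻¹≡0) (zeroʳ x)))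

  IsNonsquare : Fin q → Set
  IsNonsquare x = ∀ y → y * y ≢ x

  nonzeroSquare? : Decidable IsNonzeroSquare
  nonzeroSquare? x = ¬? (x ≟ 0#) ×-dec Fin.any? (λ y → y * y ≟ x)

  nonsquare? : Decidable IsNonsquare
  nonsquare? x = Fin.all? (λ y → ¬? (y * y ≟ x))

  root≢0 : ∀ {x y} → y * y ≡ x → x ≢ 0# → y ≢ 0#
  root≢0 {x} {y} y²≡x x≢0 y≡0 = x≢0 (trans (sym y²≡x) (trans (cong (λ v → v * v) y≡0) (zeroʳ 0#)))

  nonsquare≢0 : ∀ {x} → IsNonsquare x → x ≢ 0#
  nonsquare≢0 x-ns x≡0 = x-ns 0# (trans (zeroʳ 0#) (sym x≡0))

module Squares {q : ℕ} (F : FieldOn q) (q-odd : ∀ k → q ≢ k ℕ.+ k) where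

  open FieldOn F using (0#; 1#; 1≢0) renaming (_+_ to infixl 6 _+_; _*_ to infixl 7 _*_; -_ to infix 8 -_)
  open FieldProperties F
  open Paley F using (IsNonzeroSquare)
  open CommutativeRing ring using (+-assoc; +-identityʳ; -‿inverseʳ; *-assoc; *-comm; *-identityˡ; distribʳ; +-abelianGroup; *-commutativeSemigroup)
  open import Algebra.Properties.CommutativeSemigroup *-commutativeSemigroup using (interchange)
  open import Algebra.Properties.AbelianGroup +-abelianGroup using (⁻¹-involutive; loop)
  open import Algebra.Properties.Loop loop using (identityʳ-unique)
  open ≡-Reasoning

  1+1≢0 : 1# + 1# ≢ 0#
  1+1≢0 2≡0 = q-odd ∣ ⊤ ∩ ascending (_+ 1#) ∣ (trans (sym (∣⊤∣≡n q)) (involution⇒∣p∣≡2∣p∩ascending∣ (_+ 1#) (λ _ → ∈⊤) [x+1]+1≡x (λ _ → x+1≢x)))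
    where
    [x+1]+1≡x : ∀ x → x + 1# + 1# ≡ x
    [x+1]+1≡x x = trans (+-assoc x 1# 1#) (trans (cong (x +_) 2≡0) (+-identityʳ x))
    x+1≢x : ∀ {x} → x + 1# ≢ x
    x+1≢x {x} e = 1≢0 (identityʳ-unique x 1# e)

  x+x≡0⇒x≡0 : ∀ {x} → x + x ≡ 0# → x ≡ 0#
  x+x≡0⇒x≡0 {x} x+x≡0 with *-integral (1# + 1#) x (trans (distribʳ x 1# 1#) (trans (cong₂ _+_ (*-identityˡ x) (*-identityˡ x)) x+x≡0))
  ... | inj₁ 2≡0 = contradiction 2≡0 1+1≢0
  ... | inj₂ x≡0 = x≡0

  -x≢x : ∀ {x} → x ≢ 0# → - x ≢ x
  -x≢x {x} x≢0 -x≡x = x≢0 (x+x≡0⇒x≡0 (trans (cong (x +_) (sym -x≡x)) (-‿inverseʳ x)))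

  nonzero squares nonsquares half : Subset q
  nonzero    = ∁ ⁅ 0# ⁆
  squares    = subset nonzeroSquare?
  nonsquares = subset nonsquare?
  half       = nonzero ∩ ascending (-_)

  H : ℕ
  H = ∣ half ∣

  ∈-nonzero : ∀ {x} → x ∈ nonzero ⇔ x ≢ 0#
  ∈-nonzero = mk⇔ (x∉⁅y⁆⇒x≢y ∘ x∈∁p⇒x∉p) (x∉p⇒x∈∁p ∘ x≢y⇒x∉⁅y⁆)

  ∈-half : ∀ {x} → x ∈ half ⇔ (x ≢ 0# × toℕ x ℕ.< toℕ (- x))
  ∈-half {x} = mk⇔
    (λ x∈ → Product.map (Equivalence.to ∈-nonzero) (Equivalence.to (∈-ascending (-_))) (x∈p∩q⁻ nonzero _ x∈))
    (λ (x≢0 , x<-x) → x∈p∩q⁺ (Equivalence.from ∈-nonzero x≢0 , Equivalence.from (∈-ascending (-_)) x<-x))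

  ∈-squares : ∀ {x} → x ∈ squares ⇔ IsNonzeroSquare x
  ∈-squares = ∈-subset nonzeroSquare?

  ∈-nonsquares : ∀ {x} → x ∈ nonsquares ⇔ IsNonsquare x
  ∈-nonsquares = ∈-subset nonsquare?

  q≡1+∣nonzero∣ : q ≡ suc ∣ nonzero ∣
  q≡1+∣nonzero∣ = begin
    q                                           ≡⟨ sym (∣⊤∣≡n q) ⟩
    ∣ ⊤ {q} ∣                                   ≡⟨ sym (∣p∩q∣+∣p∩∁q∣≡∣p∣ ⊤ ⁅ 0# ⁆) ⟩
    ∣ ⊤ ∩ ⁅ 0# ⁆ ∣ ℕ.+ ∣ ⊤ ∩ nonzero ∣          ≡⟨ cong₂ ℕ._+_ (trans (cong ∣_∣ (∩-identityˡ ⁅ 0# ⁆)) (∣⁅x⁆∣≡1 0#)) (cong ∣_∣ (∩-identityˡ nonzero)) ⟩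
    suc ∣ nonzero ∣                             ∎

  ∣nonzero∣≡H+H : ∣ nonzero ∣ ≡ H ℕ.+ H
  ∣nonzero∣≡H+H = involution⇒∣p∣≡2∣p∩ascending∣ (-_)
    (Equivalence.from ∈-nonzero ∘ -x≢0 ∘ Equivalence.to ∈-nonzero) ⁻¹-involutive (-x≢x ∘ Equivalence.to ∈-nonzero)

  q≡1+2H : q ≡ suc (H ℕ.+ H)
  q≡1+2H = trans q≡1+∣nonzero∣ (cong suc ∣nonzero∣≡H+H)

  q≤4H : 2 ≤ q → q ≤ 4 ℕ.* H
  q≤4H 2≤q = subst (_≤ 4 ℕ.* H) (sym q≡1+2H) (1+2h≤4h {H} (subst (2 ≤_) q≡1+2H 2≤q))

  root-in-half : ∀ {y} → y ≢ 0# → y ∈ half ⊎ - y ∈ half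
  root-in-half {y} y≢0 with Fin.<-cmp y (- y)
  ... | tri< y<-y _ _ = inj₁ (Equivalence.from ∈-half (y≢0 , y<-y))
  ... | tri≈ _ y≡-y _ = contradiction (sym y≡-y) (-x≢x y≢0)
  ... | tri> _ _ -y<y = inj₂ (Equivalence.from ∈-half
    (-x≢0 y≢0 ,
     subst (λ v → toℕ (- y) ℕ.< toℕ v) (sym (⁻¹-involutive y)) -y<y))

  halfRoot : Fin q → Fin q
  halfRoot s with Fin.any? (λ y → (y ∈? half) ×-dec (y * y ≟ s))
  ... | yes (y , _) = y
  ... | no _        = 0#

  halfRoot-spec : ∀ {s} → s ∈ squares → halfRoot s ∈ half × halfRoot s * halfRoot s ≡ s
  halfRoot-spec {s} s∈ with Fin.any? (λ y → (y ∈? half) ×-dec (y * y ≟ s)) | Equivalence.to ∈-squares s∈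
  ... | yes (_ , found) | _ = found
  ... | no none | s≢0 , y , y²≡s with root-in-half (root≢0 y²≡s s≢0)
  ...   | inj₁ y∈half  = contradiction (y , y∈half , y²≡s) none
  ...   | inj₂ -y∈half = contradiction (- y , -y∈half , trans (-x*-y≡x*y y y) y²≡s) none

  ∣squares∣≡H : ∣ squares ∣ ≡ H
  ∣squares∣≡H = ≤-antisym
    (injective⇒∣p∣≤∣r∣ halfRoot (proj₁ ∘ halfRoot-spec) λ s∈ s′∈ e →
      trans (sym (proj₂ (halfRoot-spec s∈))) (trans (cong (λ v → v * v) e) (proj₂ (halfRoot-spec s′∈))))
    (injective⇒∣p∣≤∣r∣ (λ y → y * y) square-of-half λ {y} {z} y∈ z∈ e → [ id , opposite⇒equal y∈ z∈ ]′ (square-injective e))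
    where
    square-of-half : ∀ {y} → y ∈ half → y * y ∈ squares
    square-of-half {y} y∈ = let y≢0 = proj₁ (Equivalence.to ∈-half y∈) in
      Equivalence.from ∈-squares (*-nonzero y≢0 y≢0 , y , refl)
    opposite⇒equal : ∀ {y z} → y ∈ half → z ∈ half → y ≡ - z → y ≡ z
    opposite⇒equal {y} {z} y∈ z∈ y≡-z = contradiction y<z (Fin.<-asym z<y)
      where
      y<z : toℕ y ℕ.< toℕ z
      y<z = subst (λ v → toℕ y ℕ.< toℕ v) (trans (cong -_ y≡-z) (⁻¹-involutive z)) (proj₂ (Equivalence.to ∈-half y∈))
      z<y : toℕ z ℕ.< toℕ y
      z<y = subst (λ v → toℕ z ℕ.< toℕ v) (sym y≡-z) (proj₂ (Equivalence.to ∈-half z∈))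

  ∣nonsquares∣≡H : ∣ nonsquares ∣ ≡ H
  ∣nonsquares∣≡H = +-cancelˡ-≡ H _ _ (begin
    H ℕ.+ ∣ nonsquares ∣                                 ≡⟨ cong₂ ℕ._+_ (sym ∣squares∣≡H) (cong ∣_∣ (sym nonzero∖squares)) ⟩
    ∣ squares ∣ ℕ.+ ∣ nonzero ∩ ∁ squares ∣               ≡⟨ cong (ℕ._+ ∣ nonzero ∩ ∁ squares ∣) (cong ∣_∣ (sym nonzero∩squares)) ⟩
    ∣ nonzero ∩ squares ∣ ℕ.+ ∣ nonzero ∩ ∁ squares ∣     ≡⟨ ∣p∩q∣+∣p∩∁q∣≡∣p∣ nonzero squares ⟩
    ∣ nonzero ∣                                          ≡⟨ ∣nonzero∣≡H+H ⟩
    H ℕ.+ H                                              ∎)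
    where
    nonzero∩squares : nonzero ∩ squares ≡ squares
    nonzero∩squares = ⊆-antisym (λ x∈ → proj₂ (x∈p∩q⁻ nonzero squares x∈))
      (λ x∈ → x∈p∩q⁺ (Equivalence.from ∈-nonzero (proj₁ (Equivalence.to ∈-squares x∈)) , x∈))
    nonzero∖squares : nonzero ∩ ∁ squares ≡ nonsquares
    nonzero∖squares = ⊆-antisym
      (λ x∈ → let x∈nz , x∉sq = x∈p∩q⁻ nonzero (∁ squares) x∈ in Equivalence.from ∈-nonsquares λ y y²≡x →
         x∈∁p⇒x∉p x∉sq (Equivalence.from ∈-squares (Equivalence.to ∈-nonzero x∈nz , y , y²≡x)))
      (λ x∈ → let x-ns = Equivalence.to ∈-nonsquares x∈ in x∈p∩q⁺
         (Equivalence.from ∈-nonzero (nonsquare≢0 x-ns) ,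
          x∉p⇒x∈∁p (λ x∈sq → let _ , y , y²≡x = Equivalence.to ∈-squares x∈sq in x-ns y y²≡x)))

  nonsquare-*-square : ∀ {a s} → IsNonsquare a → IsNonzeroSquare s → IsNonsquare (a * s)
  nonsquare-*-square {a} a-ns (s≢0 , u , u²≡s) t t²≡as =
    a-ns (t * u ⁻¹) (sym (square-quotient (root≢0 u²≡s s≢0) (trans (cong (a *_) u²≡s) (sym t²≡as))))

  nonsquare-quotient : ∀ {a b} → IsNonsquare a → IsNonsquare b → ∃[ s ] (IsNonzeroSquare s × a * s ≡ b)
  nonsquare-quotient {a} {b} a-ns b-ns =
    Product.map₂ (Product.map₁ (Equivalence.to ∈-squares))
      (injective⇒onto {p = squares} {r = nonsquares} (a *_) a*square inj (≤-reflexive (trans ∣nonsquares∣≡H (sym ∣squares∣≡H)))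
        (Equivalence.from ∈-nonsquares b-ns))
    where
    a*square : ∀ {s} → s ∈ squares → a * s ∈ nonsquares
    a*square s∈ = Equivalence.from ∈-nonsquares (nonsquare-*-square a-ns (Equivalence.to ∈-squares s∈))
    inj : ∀ {s s′} → s ∈ squares → s′ ∈ squares → a * s ≡ a * s′ → s ≡ s′
    inj {s} {s′} _ _ e = *-cancelʳ s s′ (nonsquare≢0 a-ns) (trans (*-comm s a) (trans e (*-comm a s′)))

  nonsquare-*-nonsquare : ∀ {a b} → IsNonsquare a → IsNonsquare b → IsNonzeroSquare (a * b)
  nonsquare-*-nonsquare {a} {b} a-ns b-ns = square (nonsquare-quotient a-ns b-ns)
    where
    square : ∃[ s ] (IsNonzeroSquare s × a * s ≡ b) → IsNonzeroSquare (a * b)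
    square (s , (_ , u , u²≡s) , as≡b) = *-nonzero (nonsquare≢0 a-ns) (nonsquare≢0 b-ns) , a * u , (begin
      a * u * (a * u)     ≡⟨ interchange a u a u ⟩
      a * a * (u * u)     ≡⟨ cong (a * a *_) u²≡s ⟩
      a * a * s           ≡⟨ *-assoc a a s ⟩
      a * (a * s)         ≡⟨ cong (a *_) as≡b ⟩
      a * b               ∎)

module PaleyGraph {q : ℕ} (F : FieldOn q) where

  open FieldProperties F
  open Paley F

  InN? : ∀ x c → Dec (InN[ x ] c)
  InN? x c = (c ≟ x) ⊎-dec (¬? (x ≟ c) ×-dec nonzeroSquare? (x - c))

  N[_] : Fin q → Subset q
  N[ x ] = subset (InN? x)

  ∈-N : ∀ {x c} → c ∈ N[ x ] ⇔ InN[ x ] c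
  ∈-N {x} = ∈-subset (InN? x)

  identifying-lower-bound : (C : Subset q) → IsIdentifying C → q ≤ 2 ^ ∣ C ∣
  identifying-lower-bound C (_ , separated) = separating-family-size C N[_] λ {x} {y} same →
    decidable-stable (x ≟ y) (λ x≢y → separated x y x≢y λ c c∈C →
      mk⇔ (agree same c∈C) (agree (sym same) c∈C))
    where
    agree : ∀ {x y c} → C ∩ N[ x ] ≡ C ∩ N[ y ] → c ∈ C → InN[ x ] c → InN[ y ] c
    agree {c = c} same c∈C c∈Nx = Equivalence.to ∈-N (proj₂ (x∈p∩q⁻ C _ (subst (c ∈_) same (x∈p∩q⁺ (c∈C , Equivalence.from ∈-N c∈Nx)))))

module PaleyRequirements {q : ℕ} (F : FieldOn q) (q-odd : ∀ k → q ≢ k ℕ.+ k) where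

  open FieldOn F using (0#; 1#) renaming (_+_ to infixl 6 _+_; _*_ to infixl 7 _*_; -_ to infix 8 -_)
  open FieldProperties F
  open Squares F q-odd
  open Paley F
  open PaleyGraph F
  open CommutativeRing ring using (-‿inverseʳ; *-comm; *-identityʳ; +-abelianGroup)
  open import Algebra.Properties.AbelianGroup +-abelianGroup using (x∙y⁻¹≈ε⇒x≈y)
  open ≡-Reasoning

  ∈N-of-square : ∀ {x c} → IsNonzeroSquare (x - c) → InN[ x ] c
  ∈N-of-square {x} sq@(x-c≢0 , _) = inj₂ ((λ x≡c → x-c≢0 (trans (cong (_-_ x) (sym x≡c)) (-‿inverseʳ x))) , sq)

  ∉N-of-nonsquare : ∀ {x c} → IsNonsquare (x - c) → ¬ InN[ x ] c
  ∉N-of-nonsquare {x} x-c-ns (inj₁ c≡x) = nonsquare≢0 x-c-ns (trans (cong (_-_ x) c≡x) (-‿inverseʳ x))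
  ∉N-of-nonsquare x-c-ns (inj₂ (_ , _ , y , y²≡x-c)) = x-c-ns y y²≡x-c

  Separates : Fin q → Fin q → Fin q → Set
  Separates x y c = (InN[ x ] c × ¬ InN[ y ] c) ⊎ (InN[ y ] c × ¬ InN[ x ] c)

  separates? : ∀ x y c → Dec (Separates x y c)
  separates? x y c = (InN? x c ×-dec ¬? (InN? y c)) ⊎-dec (InN? y c ×-dec ¬? (InN? x c))

  Separates⇒¬⇔ : ∀ {x y c} → Separates x y c → ¬ (InN[ x ] c ⇔ InN[ y ] c)
  Separates⇒¬⇔ (inj₁ (in-x , ∉y)) x⇔y = ∉y (Equivalence.to x⇔y in-x)
  Separates⇒¬⇔ (inj₂ (in-y , ∉x)) x⇔y = ∉x (Equivalence.from x⇔y in-y)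

  H≤∣N∣ : ∀ x → H ≤ ∣ N[ x ] ∣
  H≤∣N∣ x = subst (_≤ ∣ N[ x ] ∣) ∣squares∣≡H (injective⇒∣p∣≤∣r∣ (_-_ x)
    (λ s∈ → Equivalence.from ∈-N (∈N-of-square (subst IsNonzeroSquare (sym (x-[x-y]≡y x _)) (Equivalence.to ∈-squares s∈))))
    (λ {s} {s′} _ _ e → trans (sym (x-[x-y]≡y x s)) (trans (cong (_-_ x) e) (x-[x-y]≡y x s′))))

  module Separation (x y : Fin q) (x≢y : x ≢ y) where

    -- point r is the z with x - z = r (y - z), and y - z = offset r.
    offset point : Fin q → Fin q
    offset r = (x - y) * (r - 1#) ⁻¹
    point r = y - offset r

    r-1≢0 : ∀ {r} → IsNonsquare r → r - 1# ≢ 0#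
    r-1≢0 {r} r-ns r-1≡0 = r-ns 1# (trans (*-identityʳ 1#) (sym (x∙y⁻¹≈ε⇒x≈y r 1# r-1≡0)))

    offset≢0 : ∀ {r} → IsNonsquare r → offset r ≢ 0#
    offset≢0 r-ns = *-nonzero (x≢y ∘ x∙y⁻¹≈ε⇒x≈y x y) (⁻¹≢0 (r-1≢0 r-ns))

    y-point : ∀ r → y - point r ≡ offset r
    y-point r = x-[x-y]≡y y (offset r)

    x-point : ∀ {r} → IsNonsquare r → x - point r ≡ r * offset r
    x-point {r} r-ns = begin
      x - (y - offset r)                       ≡⟨ x-[y-w]≡[x-y]+w x y (offset r) ⟩
      (x - y) + offset r                       ≡⟨ cong (_+ offset r) (sym (a*b⁻¹*b≡a (x - y) (r-1≢0 r-ns))) ⟩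
      (x - y) * (r - 1#) ⁻¹ * (r - 1#) + offset r ≡⟨ cong (_+ offset r) (*-comm (offset r) (r - 1#)) ⟩
      (r - 1#) * offset r + offset r           ≡⟨ [r-1]*w+w≡r*w r (offset r) ⟩
      r * offset r                             ∎

    point-separates : ∀ {r} → IsNonsquare r → Separates x y (point r)
    point-separates {r} r-ns with nonzeroSquare? (offset r)
    ... | yes w-sq = inj₂ (∈N-of-square (subst IsNonzeroSquare (sym (y-point r)) w-sq) ,
                           ∉N-of-nonsquare (subst IsNonsquare (sym (x-point r-ns)) (nonsquare-*-square r-ns w-sq)))
    ... | no w-not-sq = inj₁ (∈N-of-square (subst IsNonzeroSquare (sym (x-point r-ns)) (nonsquare-*-nonsquare r-ns w-ns)) ,
                              ∉N-of-nonsquare (subst IsNonsquare (sym (y-point r)) w-ns))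
      where
      w-ns : IsNonsquare (offset r)
      w-ns t t²≡w = w-not-sq (offset≢0 r-ns , t , t²≡w)

    point-injective : ∀ {r r′} → IsNonsquare r → IsNonsquare r′ → point r ≡ point r′ → r ≡ r′
    point-injective {r} {r′} r-ns r′-ns e = *-cancelʳ r r′ (offset≢0 r-ns) (begin
      r * offset r        ≡⟨ sym (x-point r-ns) ⟩
      x - point r         ≡⟨ cong (_-_ x) e ⟩
      x - point r′        ≡⟨ x-point r′-ns ⟩
      r′ * offset r′      ≡⟨ cong (r′ *_) (trans (sym (y-point r′)) (trans (cong (_-_ y) (sym e)) (y-point r))) ⟩
      r′ * offset r       ∎)

    H≤∣separators∣ : H ≤ ∣ subset (separates? x y) ∣
    H≤∣separators∣ = subst (_≤ ∣ subset (separates? x y) ∣) ∣nonsquares∣≡H (injective⇒∣p∣≤∣r∣ point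
      (λ r∈ → Equivalence.from (∈-subset (separates? x y)) (point-separates (Equivalence.to ∈-nonsquares r∈)))
      (λ r∈ r′∈ → point-injective (Equivalence.to ∈-nonsquares r∈) (Equivalence.to ∈-nonsquares r′∈)))

  requirement : Fin q → Fin q → Subset q
  requirement x y with x ≟ y
  ... | yes _ = N[ x ]
  ... | no  _ = subset (separates? x y)

  H≤∣requirement∣ : ∀ x y → H ≤ ∣ requirement x y ∣
  H≤∣requirement∣ x y with x ≟ y
  ... | yes _   = H≤∣N∣ x
  ... | no  x≢y = Separation.H≤∣separators∣ x y x≢y

  meeting-requirements⇒identifying : ∀ C → (∀ x y → Meets C (requirement x y)) → IsIdentifying C
  meeting-requirements⇒identifying C meets = dominated , separated
    where
    dominated : ∀ x → ∃[ c ] (c ∈ C × InN[ x ] c)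
    dominated x with x ≟ x | meets x x
    ... | yes _  | c , c∈C , c∈N = c , c∈C , Equivalence.to ∈-N c∈N
    ... | no x≢x | _             = contradiction refl x≢x
    separated : ∀ x y → x ≢ y → ¬ (∀ c → c ∈ C → (InN[ x ] c ⇔ InN[ y ] c))
    separated x y x≢y agree with x ≟ y | meets x y
    ... | yes x≡y | _             = x≢y x≡y
    ... | no _    | c , c∈C , c∈S = Separates⇒¬⇔ (Equivalence.to (∈-subset (separates? x y)) c∈S) (agree c c∈C)

  requirements : List (Subset q)
  requirements = List.tabulate (uncurry requirement ∘ remQuot {q} q)

  requirement-large : 2 ≤ q → ∀ x y → Large (requirement x y)
  requirement-large 2≤q x y = ≤-trans (q≤4H 2≤q) (*-monoʳ-≤ 4 (H≤∣requirement∣ x y))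

  identifying-upper-bound : 2 ≤ q → ∃[ C ] (IsIdentifying C × 2 ^ ∣ C ∣ ≤ 1 ⊔ 2 ℕ.* (q ℕ.* q) ^ 3)
  identifying-upper-bound 2≤q
    with hitting-set (≤-trans (s≤s z≤n) 2≤q) requirements (tabulate⁺ λ k → requirement-large 2≤q (proj₁ (remQuot {q} q k)) (proj₂ (remQuot {q} q k)))
  ... | C , meets , bound = C ,
    meeting-requirements⇒identifying C (λ x y → subst (Meets C) (cong (uncurry requirement) (Fin.remQuot-combine x y)) (tabulate⁻ meets (combine x y))) ,
    subst (λ l → 2 ^ ∣ C ∣ ≤ 1 ⊔ 2 ℕ.* l ^ 3) (length-tabulate (uncurry requirement ∘ remQuot {q} q)) bound

open import Data.Nat using (ℕ; _*_; _^_; _≤_; _≥_; _%_)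
open import Data.Nat.Properties using (*-identityˡ)
open import Data.Fin.Subset using (Subset; ∣_∣)
open import Data.Product using (Σ; ∃-syntax; _×_)
open import Relation.Binary.PropositionalEquality using (_≡_)

theorem33 : Σ ℕ λ A → Σ ℕ λ B → Σ ℕ λ N →
    ∀ (q : ℕ) → q ≥ N → IsPrimePower q → q % 4 ≡ 1 → (F : FieldOn q) →
    ((C : Subset q) → Paley.IsIdentifying F C → q ≤ 2 ^ (A * ∣ C ∣)) ×
    (∃[ C ] (Paley.IsIdentifying F C × 2 ^ ∣ C ∣ ≤ q ^ B))
theorem33 = 1 , 7 , 2 , λ q 2≤q _ q%4≡1 F →
  (λ C identifying → subst (λ m → q ≤ 2 ^ m) (sym (*-identityˡ ∣ C ∣)) (PaleyGraph.identifying-lower-bound F C identifying)) ,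
  (let C , identifying , bound = PaleyRequirements.identifying-upper-bound F (1mod4⇒odd q%4≡1) 2≤q
   in C , identifying , ≤-trans bound (1⊔2[q²]³≤q⁷ 2≤q))
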